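{- Let $k\ge 2$ be an integer and define probability distributions $\mathbf p,\mathbf q$ on $[k]=\{1,\dots,k\}$ as follows. If $k$ is even: $\mathbf p_i=0$ for even $i$, $\mathbf p_i=\frac{1}{2^{k-1}}\binom{k}{i}$ for odd $i$; $\mathbf q_i=\frac{1}{2^{k-1}-1}\binom{k}{i}$ for even $i$, $\mathbf q_i=0$ for odd $i$. If $k$ is odd: $\mathbf p_i=\frac{1}{2^{k-1}-1}\binom{k}{i}$ for even $i$, $\mathbf p_i=0$ for odd $i$; $\mathbf q_i=0$ for even $i$, $\mathbf q_i=\frac{1}{2^{k-1}}\binom{k}{i}$ for odd $i$. Then: (1) $\mathbf p_k=0$ and $\mathbf q_k\ge \frac{1}{2^k}$; (2) for any random variables $X_A\sim\mathbf p$ and $X_B\sim\mathbf q$, $X_A$ and $X_B$ have $k-1$ proportional moments.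
   Context: Two random variables $X_1,X_2$ have $k-1$ proportional moments if $\frac{\mathbf E[X_2]}{\mathbf E[X_1]}=\frac{\mathbf E[X_2^2]}{\mathbf E[X_1^2]}=\cdots=\frac{\mathbf E[X_2^{k-1}]}{\mathbf E[X_1^{k-1}]}$. -}

module Defs where

open import Data.Nat as ℕ using (ℕ; zero; suc; _∸_; _≡ᵇ_; _%_)
open import Data.Nat.Combinatorics using (_C_)
open import Data.Integer using (+_)
open import Data.Rational using (ℚ; 0ℚ; _+_; _*_; _÷_; _/_; ≢-nonZero)
open import Data.Rational.Properties using (_≟_)
open import Data.Bool using (Bool; true; false; if_then_else_)
open import Data.List using (List; map; foldr; upTo)
open import Relation.Nullary using (yes; no; ¬_)
open import Relation.Binary.PropositionalEquality using (_≡_)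
open import Data.Product using (_×_)

ℕ→ℚ : ℕ → ℚ
ℕ→ℚ n = (+ n) / 1

_^ℚ_ : ℚ → ℕ → ℚ
x ^ℚ zero = (+ 1) / 1
x ^ℚ suc n = x * (x ^ℚ n)

-- a / b, used only with b ≠ 0 (returns 0 if b = 0, a dummy value never used
-- in a meaningful way below)
_÷?_ : ℚ → ℚ → ℚ
a ÷? b with b ≟ 0ℚ
... | yes _  = 0ℚ
... | no b≢0 = _÷_ a b {{≢-nonZero b≢0}}

isEven : ℕ → Bool
isEven i = (i % 2) ≡ᵇ 0

sumFrom1 : ℕ → (ℕ → ℚ) → ℚ
sumFrom1 k f = foldr _+_ 0ℚ (map (λ i → f (suc i)) (upTo k))

A : ℕ → ℚ
A k = ℕ→ℚ (2 ℕ.^ (k ∸ 1))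

B : ℕ → ℚ
B k = ℕ→ℚ ((2 ℕ.^ (k ∸ 1)) ∸ 1)

binomℚ : ℕ → ℕ → ℚ
binomℚ k i = ℕ→ℚ (k C i)

-- the distributions p, q on [k] (values for i ∉ [k] are irrelevant)
𝐩 : ℕ → ℕ → ℚ
𝐩 k i = if isEven k
          then (if isEven i then 0ℚ else binomℚ k i ÷? A k)
          else (if isEven i then binomℚ k i ÷? B k else 0ℚ)

𝐪 : ℕ → ℕ → ℚ
𝐪 k i = if isEven k
          then (if isEven i then binomℚ k i ÷? B k else 0ℚ)
          else (if isEven i then 0ℚ else binomℚ k i ÷? A k)

moment : ℕ → (ℕ → ℚ) → ℕ → ℚ
moment k d j = sumFrom1 k (λ i → d i * (ℕ→ℚ i ^ℚ j))

ProportionalMoments : ℕ → (ℕ → ℚ) → (ℕ → ℚ) → Set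
ProportionalMoments k m₁ m₂ =
  (∀ j → 1 ℕ.≤ j → j ℕ.≤ k ∸ 1 → ¬ (m₁ j ≡ 0ℚ)) ×
  (∀ i j → 1 ℕ.≤ i → i ℕ.≤ k ∸ 1 → 1 ℕ.≤ j → j ℕ.≤ k ∸ 1 →
     (m₂ i ÷? m₁ i) ≡ (m₂ j ÷? m₁ j))

-- Write Eₖ f and Oₖ f for Σ (k choose i) f(i) over the even, resp. odd, i ≤ k.
-- Pascal's rule turns Eₖ f − Oₖ f into ± the k-th forward difference of f, which
-- vanishes when f is a polynomial of degree < k; for f(i) = iʲ with 1 ≤ j < k the
-- i = 0 term is 0, so the even and odd binomial moments Σ (k choose i) iʲ agree.
-- The j-th moments of p and q are this common value Sⱼ times the normalising
-- constants 1/2ᵏ⁻¹ and 1/(2ᵏ⁻¹ − 1) (in some order), and Sⱼ ≥ k > 0, so every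
-- ratio of moments equals the ratio of these constants.
module Submission where

open import Defs
open import Data.Nat.Combinatorics using (_C_; nCk+nC[k+1]≡[n+1]C[k+1]; k>n⇒nCk≡0; nC1≡n; nCn≡1)
open import Data.Nat as ℕ using (ℕ; zero; suc; _≥_; _^_; _∸_; s≤s; z≤n)
import Data.Nat.Properties as ℕ
open import Data.Nat.Coprimality as Coprime using ()
open import Data.Integer as ℤ using (+_)
import Data.Integer.Properties as ℤ
open import Data.Fin as Fin using (toℕ)
import Data.Fin.Properties as Fin
open import Data.Rational using (ℚ; 0ℚ; 1ℚ; mkℚ; _+_; _*_; _-_; -_; _/_; 1/_; _≤_; *≤*; Positive; NonNegative; positive; ≢-nonZero)
open import Relation.Nullary using (yes; no; contradiction)
open import Data.Rational.Properties
open import Algebra.Bundles using (CommutativeMonoid; CommutativeRing)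
import Algebra.Properties.Group +-0-group as +-Group
import Algebra.Properties.CommutativeSemigroup (CommutativeMonoid.commutativeSemigroup +-0-commutativeMonoid) as +-CS
import Algebra.Properties.CommutativeSemigroup (CommutativeMonoid.commutativeSemigroup *-1-commutativeMonoid) as *-CS
open import Algebra.Properties.Semiring.Sum (CommutativeRing.semiring +-*-commutativeRing) using (sum; ∑-distrib-+; sum-init-last; sum-cong-≗; *-distribʳ-sum)
open import Relation.Nullary.Decidable using (dec⇒maybe)
open import Data.List using (foldr; map; applyUpTo)
open import Data.Product using (_×_; _,_; proj₁)
open import Function using (_∘_)
open import Data.Bool using (true; false; if_then_else_)
open import Data.Bool.Properties using (if-cong)
open import Data.Vec.Functional using (Vector)
open import Relation.Binary.PropositionalEquality
open import Tactic.RingSolver using (solve-∀)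
open import Tactic.RingSolver.Core.AlmostCommutativeRing using (AlmostCommutativeRing; fromCommutativeRing)

ℚ-ring : AlmostCommutativeRing _ _
ℚ-ring = fromCommutativeRing +-*-commutativeRing (λ x → dec⇒maybe (0ℚ ≟ x))

ℕ→ℚ≡mkℚ : ∀ n → ℕ→ℚ n ≡ mkℚ (+ n) 0 (Coprime.sym (Coprime.1-coprimeTo n))
ℕ→ℚ≡mkℚ n = normalize-coprime (Coprime.sym (Coprime.1-coprimeTo n))

ℕ→ℚ-homo-+ : ∀ m n → ℕ→ℚ (m ℕ.+ n) ≡ ℕ→ℚ m + ℕ→ℚ n
ℕ→ℚ-homo-+ m n = begin
  ℕ→ℚ (m ℕ.+ n)                              ≡⟨ cong (_/ 1) (sym (cong₂ ℤ._+_ (ℤ.*-identityʳ (+ m)) (ℤ.*-identityʳ (+ n)))) ⟩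
  (+ m ℤ.* + 1 ℤ.+ + n ℤ.* + 1) / 1          ≡⟨ sym (cong₂ _+_ (ℕ→ℚ≡mkℚ m) (ℕ→ℚ≡mkℚ n)) ⟩
  ℕ→ℚ m + ℕ→ℚ n                              ∎
  where open ≡-Reasoning

ℕ→ℚ-mono-≤ : ∀ {m n} → m ℕ.≤ n → ℕ→ℚ m ≤ ℕ→ℚ n
ℕ→ℚ-mono-≤ {m} {n} m≤n = subst₂ _≤_ (sym (ℕ→ℚ≡mkℚ m)) (sym (ℕ→ℚ≡mkℚ n))
  (*≤* (ℤ.*-monoʳ-≤-nonNeg (+ 1) (ℤ.+≤+ m≤n)))

ℕ→ℚ-nonNeg : ∀ n → NonNegative (ℕ→ℚ n)
ℕ→ℚ-nonNeg n = normalize-nonNeg n 1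

ℕ→ℚ-pos : ∀ n .{{_ : ℕ.NonZero n}} → Positive (ℕ→ℚ n)
ℕ→ℚ-pos n = normalize-pos n 1

pos⇒≢0 : ∀ p → Positive p → p ≢ 0ℚ
pos⇒≢0 _ () refl

∑≤ : ℕ → (ℕ → ℚ) → ℚ
∑≤ n f = sum {suc n} (f ∘ toℕ)

∑≤-cong : ∀ n {f g : ℕ → ℚ} → (∀ i → f i ≡ g i) → ∑≤ n f ≡ ∑≤ n g
∑≤-cong n f≗g = sum-cong-≗ {suc n} (f≗g ∘ toℕ)

∑≤-neg : ∀ n (f : ℕ → ℚ) → ∑≤ n (λ i → - f i) ≡ - ∑≤ n f
∑≤-neg zero    f = sym (neg-distrib-+ (f 0) 0ℚ)
∑≤-neg (suc n) f = trans (cong (_+_ (- f 0)) (∑≤-neg n (f ∘ suc))) (sym (neg-distrib-+ (f 0) _))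

∑≤-distrib-- : ∀ n (f g : ℕ → ℚ) → ∑≤ n (λ i → f i - g i) ≡ ∑≤ n f - ∑≤ n g
∑≤-distrib-- n f g = trans (∑-distrib-+ {suc n} (f ∘ toℕ) (λ i → - g (toℕ i))) (cong (_+_ (∑≤ n f)) (∑≤-neg n g))

∑≤-distribʳ-* : ∀ n (f : ℕ → ℚ) c → ∑≤ n (λ i → f i * c) ≡ ∑≤ n f * c
∑≤-distribʳ-* n f c = sym (*-distribʳ-sum {suc n} c (f ∘ toℕ))

∑≤-last : ∀ n (f : ℕ → ℚ) → ∑≤ (suc n) f ≡ ∑≤ n f + f (suc n)
∑≤-last n f = trans (sum-init-last {suc n} (f ∘ toℕ))
  (cong₂ _+_ (sum-cong-≗ {suc n} (cong f ∘ Fin.toℕ-inject₁)) (cong f (Fin.toℕ-fromℕ (suc n))))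

sum-nonNeg : ∀ {n} (v : Vector ℚ n) → (∀ i → NonNegative (v i)) → NonNegative (sum v)
sum-nonNeg {zero}  v v≥0 = _
sum-nonNeg {suc n} v v≥0 = nonNeg+nonNeg⇒nonNeg (v Fin.zero) {{v≥0 Fin.zero}} _ {{sum-nonNeg (v ∘ Fin.suc) (v≥0 ∘ Fin.suc)}}

sumFrom1≡∑≤ : ∀ k (f : ℕ → ℚ) → f 0 ≡ 0ℚ → sumFrom1 k f ≡ ∑≤ k f
sumFrom1≡∑≤ k f f0≡0 = begin
  sumFrom1 k f                 ≡⟨ foldr-applyUpTo k (λ i → i) ⟩
  sum {k} (f ∘ suc ∘ toℕ)      ≡⟨ sym (+-identityˡ (sum {k} (f ∘ suc ∘ toℕ))) ⟩
  0ℚ + sum {k} (f ∘ suc ∘ toℕ) ≡⟨ cong (_+ sum {k} (f ∘ suc ∘ toℕ)) (sym f0≡0) ⟩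
  ∑≤ k f                       ∎
  where
  open ≡-Reasoning
  foldr-applyUpTo : ∀ n (h : ℕ → ℕ) → foldr _+_ 0ℚ (map (f ∘ suc) (applyUpTo h n)) ≡ sum {n} (f ∘ suc ∘ h ∘ toℕ)
  foldr-applyUpTo zero    h = refl
  foldr-applyUpTo (suc n) h = cong (_+_ (f (suc (h 0)))) (foldr-applyUpTo n (h ∘ suc))

binomialSum : ℕ → (ℕ → ℚ) → (ℕ → ℚ) → ℚ
binomialSum k s f = ∑≤ k (λ i → s i * (binomℚ k i * f i))

binomℚ-pascal : ∀ k i → binomℚ (suc k) (suc i) ≡ binomℚ k i + binomℚ k (suc i)
binomℚ-pascal k i = trans (cong ℕ→ℚ (sym (nCk+nC[k+1]≡[n+1]C[k+1] k i))) (ℕ→ℚ-homo-+ (k C i) (k C suc i))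

binomialSum-pascal : ∀ k s f →
  binomialSum (suc k) s f ≡ binomialSum k s f + binomialSum k (s ∘ suc) (f ∘ suc)
binomialSum-pascal k s f = begin
  binomialSum (suc k) s f
    ≡⟨⟩
  term 0 + ∑≤ k (λ i → s (suc i) * (binomℚ (suc k) (suc i) * f (suc i)))
    ≡⟨ cong (_+_ (term 0)) (trans (∑≤-cong k split) (∑-distrib-+ {suc k} (shifted ∘ toℕ) (term ∘ suc ∘ toℕ))) ⟩
  term 0 + (∑≤ k shifted + ∑≤ k (term ∘ suc))
    ≡⟨ +-CS.x∙yz≈xz∙y (term 0) (∑≤ k shifted) (∑≤ k (term ∘ suc)) ⟩
  ∑≤ (suc k) term + ∑≤ k shifted
    ≡⟨ cong (_+ ∑≤ k shifted) (trans (∑≤-last k term) (trans (cong (_+_ (∑≤ k term)) top≡0) (+-identityʳ (∑≤ k term)))) ⟩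
  binomialSum k s f + binomialSum k (s ∘ suc) (f ∘ suc)
    ∎
  where
  open ≡-Reasoning
  term shifted : ℕ → ℚ
  term    i = s i * (binomℚ k i * f i)
  shifted i = s (suc i) * (binomℚ k i * f (suc i))
  split : ∀ i → s (suc i) * (binomℚ (suc k) (suc i) * f (suc i)) ≡ shifted i + term (suc i)
  split i = begin
    s (suc i) * (binomℚ (suc k) (suc i) * f (suc i))                 ≡⟨ cong (λ c → s (suc i) * (c * f (suc i))) (binomℚ-pascal k i) ⟩
    s (suc i) * ((binomℚ k i + binomℚ k (suc i)) * f (suc i))         ≡⟨ cong (s (suc i) *_) (*-distribʳ-+ (f (suc i)) (binomℚ k i) (binomℚ k (suc i))) ⟩
    s (suc i) * (binomℚ k i * f (suc i) + binomℚ k (suc i) * f (suc i)) ≡⟨ *-distribˡ-+ (s (suc i)) (binomℚ k i * f (suc i)) (binomℚ k (suc i) * f (suc i)) ⟩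
    shifted i + term (suc i)                                          ∎
  top≡0 : term (suc k) ≡ 0ℚ
  top≡0 = begin
    s (suc k) * (binomℚ k (suc k) * f (suc k)) ≡⟨ cong (λ c → s (suc k) * (ℕ→ℚ c * f (suc k))) (k>n⇒nCk≡0 (ℕ.n<1+n k)) ⟩
    s (suc k) * (0ℚ * f (suc k))             ≡⟨ cong (s (suc k) *_) (*-zeroˡ (f (suc k))) ⟩
    s (suc k) * 0ℚ                           ≡⟨ *-zeroʳ (s (suc k)) ⟩
    0ℚ                                       ∎

𝟙[even] 𝟙[odd] : ℕ → ℚ
𝟙[even] i = if isEven i then 1ℚ else 0ℚ
𝟙[odd]  i = if isEven i then 0ℚ else 1ℚ

𝟙[even]-suc : ∀ i → 𝟙[even] (suc i) ≡ 𝟙[odd] i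
𝟙[odd]-suc  : ∀ i → 𝟙[odd] (suc i) ≡ 𝟙[even] i
𝟙[even]-suc zero    = refl
𝟙[even]-suc (suc i) = sym (𝟙[odd]-suc i)
𝟙[odd]-suc  zero    = refl
𝟙[odd]-suc  (suc i) = sym (𝟙[even]-suc i)

Δ : (ℕ → ℚ) → ℕ → ℚ
Δ f i = f (suc i) - f i

binomialSum-Δ : ∀ k s f → binomialSum k s (Δ f) ≡ binomialSum k s (f ∘ suc) - binomialSum k s f
binomialSum-Δ k s f = trans (∑≤-cong k (λ i → distrib (s i) (binomℚ k i) (f (suc i)) (f i)))
  (∑≤-distrib-- k (λ i → s i * (binomℚ k i * f (suc i))) (λ i → s i * (binomℚ k i * f i)))
  where
  distrib : ∀ s c x y → s * (c * (x - y)) ≡ s * (c * x) - s * (c * y)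
  distrib = solve-∀ ℚ-ring

alternatingSum : ℕ → (ℕ → ℚ) → ℚ
alternatingSum k f = binomialSum k 𝟙[even] f - binomialSum k 𝟙[odd] f

alternatingSum-suc : ∀ k f → alternatingSum (suc k) f ≡ - alternatingSum k (Δ f)
alternatingSum-suc k f = begin
  alternatingSum (suc k) f
    ≡⟨ cong₂ _-_ (trans (binomialSum-pascal k 𝟙[even] f) (cong (_+_ (E f)) (selector-suc 𝟙[even] 𝟙[odd] 𝟙[even]-suc)))
                 (trans (binomialSum-pascal k 𝟙[odd] f) (cong (_+_ (O f)) (selector-suc 𝟙[odd] 𝟙[even] 𝟙[odd]-suc))) ⟩
  (E f + O (f ∘ suc)) - (O f + E (f ∘ suc))
    ≡⟨ rearrange (E f) (O f) (E (f ∘ suc)) (O (f ∘ suc)) ⟩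
  - ((E (f ∘ suc) - E f) - (O (f ∘ suc) - O f))
    ≡⟨ cong -_ (sym (cong₂ _-_ (binomialSum-Δ k 𝟙[even] f) (binomialSum-Δ k 𝟙[odd] f))) ⟩
  - alternatingSum k (Δ f)
    ∎
  where
  open ≡-Reasoning
  E O : (ℕ → ℚ) → ℚ
  E = binomialSum k 𝟙[even]
  O = binomialSum k 𝟙[odd]
  selector-suc : ∀ s t → (∀ i → s (suc i) ≡ t i) → binomialSum k (s ∘ suc) (f ∘ suc) ≡ binomialSum k t (f ∘ suc)
  selector-suc s t s≗t = ∑≤-cong k (λ i → cong (_* (binomℚ k i * f (suc i))) (s≗t i))
  rearrange : ∀ e o e′ o′ → (e + o′) - (o + e′) ≡ - ((e′ - e) - (o′ - o))
  rearrange = solve-∀ ℚ-ring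

DegreeBelow : ℕ → (ℕ → ℚ) → Set
DegreeBelow zero    f = ∀ i → f i ≡ 0ℚ
DegreeBelow (suc k) f = DegreeBelow k (Δ f)

DegreeBelow-cong : ∀ k {f g} → (∀ i → f i ≡ g i) → DegreeBelow k f → DegreeBelow k g
DegreeBelow-cong zero    f≗g f≗0 i = trans (sym (f≗g i)) (f≗0 i)
DegreeBelow-cong (suc k) f≗g = DegreeBelow-cong k (λ i → cong₂ _-_ (f≗g (suc i)) (f≗g i))

DegreeBelow-+ : ∀ k {f g} → DegreeBelow k f → DegreeBelow k g → DegreeBelow k (λ i → f i + g i)
DegreeBelow-+ zero            f≗0 g≗0 i = trans (cong₂ _+_ (f≗0 i) (g≗0 i)) (+-identityˡ 0ℚ)
DegreeBelow-+ (suc k) {f} {g} df dg =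
  DegreeBelow-cong k (λ i → interchange (f (suc i)) (g (suc i)) (f i) (g i)) (DegreeBelow-+ k df dg)
  where
  interchange : ∀ a b c d → (a - c) + (b - d) ≡ (a + b) - (c + d)
  interchange = solve-∀ ℚ-ring

DegreeBelow-shift : ∀ k {f} → DegreeBelow k f → DegreeBelow k (f ∘ suc)
DegreeBelow-shift zero    f≗0 = f≗0 ∘ suc
DegreeBelow-shift (suc k) df  = DegreeBelow-shift k df

DegreeBelow-0 : ∀ k {f} → (∀ i → f i ≡ 0ℚ) → DegreeBelow k f
DegreeBelow-0 zero    f≗0 = f≗0
DegreeBelow-0 (suc k) f≗0 = DegreeBelow-0 k (λ i → cong₂ _-_ (f≗0 (suc i)) (f≗0 i))

DegreeBelow-mono : ∀ {m n f} → m ℕ.≤ n → DegreeBelow m f → DegreeBelow n f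
DegreeBelow-mono {n = n} z≤n   f≗0 = DegreeBelow-0 n f≗0
DegreeBelow-mono         (s≤s m≤n) df  = DegreeBelow-mono m≤n df

DegreeBelow-*ℕ : ∀ k {f} → DegreeBelow k f → DegreeBelow (suc k) (λ i → ℕ→ℚ i * f i)
DegreeBelow-*ℕ zero    f≗0 = DegreeBelow-0 1 (λ i → trans (cong (ℕ→ℚ i *_) (f≗0 i)) (*-zeroʳ (ℕ→ℚ i)))
DegreeBelow-*ℕ (suc k) {f} df =
  DegreeBelow-cong (suc k) product-rule (DegreeBelow-+ (suc k) {λ i → ℕ→ℚ i * Δ f i} {f ∘ suc} (DegreeBelow-*ℕ k df) (DegreeBelow-shift (suc k) {f} df))
  where
  product-rule : ∀ i → ℕ→ℚ i * Δ f i + f (suc i) ≡ ℕ→ℚ (suc i) * f (suc i) - ℕ→ℚ i * f i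
  product-rule i = trans (leibniz (ℕ→ℚ i) (f (suc i)) (f i)) (cong (λ n → n * f (suc i) - ℕ→ℚ i * f i) (sym (ℕ→ℚ-homo-+ 1 i)))
    where
    leibniz : ∀ n x y → n * (x - y) + x ≡ (1ℚ + n) * x - n * y
    leibniz = solve-∀ ℚ-ring

monomial : ℕ → ℕ → ℚ
monomial j i = ℕ→ℚ i ^ℚ j

DegreeBelow-monomial : ∀ j → DegreeBelow (suc j) (monomial j)
DegreeBelow-monomial zero    i = refl
DegreeBelow-monomial (suc j) = DegreeBelow-*ℕ (suc j) (DegreeBelow-monomial j)

alternatingSum-vanishes : ∀ k {f} → DegreeBelow k f → alternatingSum k f ≡ 0ℚ
alternatingSum-vanishes zero    f≗0 = cong (λ x → 1ℚ * (1ℚ * x) + 0ℚ - (0ℚ * (1ℚ * x) + 0ℚ)) (f≗0 0)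
alternatingSum-vanishes (suc k) {f} df = trans (alternatingSum-suc k f) (cong -_ (alternatingSum-vanishes k df))

binomialSum-even≡odd : ∀ k {f} → DegreeBelow k f → binomialSum k 𝟙[even] f ≡ binomialSum k 𝟙[odd] f
binomialSum-even≡odd k df = +-Group.x∙y⁻¹≈ε⇒x≈y _ _ (alternatingSum-vanishes k df)

monomial-nonNeg : ∀ j i → NonNegative (monomial j i)
monomial-nonNeg zero    i = _
monomial-nonNeg (suc j) i = nonNeg*nonNeg⇒nonNeg (ℕ→ℚ i) {{ℕ→ℚ-nonNeg i}} (monomial j i) {{monomial-nonNeg j i}}

monomial-at-1 : ∀ j → monomial j 1 ≡ 1ℚ
monomial-at-1 zero    = refl
monomial-at-1 (suc j) = cong (1ℚ *_) (monomial-at-1 j)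

𝟙[odd]-nonNeg : ∀ i → NonNegative (𝟙[odd] i)
𝟙[odd]-nonNeg i with isEven i
... | true  = _
... | false = _

binomialSum-odd-monomial-pos : ∀ m j → Positive (binomialSum (suc m) 𝟙[odd] (monomial j))
binomialSum-odd-monomial-pos m j =
  nonNeg+pos⇒pos (term 0) {{term-nonNeg 0}} _
    {{pos+nonNeg⇒pos (term 1) {{subst Positive (sym term-1≡k) (ℕ→ℚ-pos (suc m))}} _
      {{sum-nonNeg {m} (term ∘ suc ∘ suc ∘ toℕ) (term-nonNeg ∘ suc ∘ suc ∘ toℕ)}}}}
  where
  k = suc m
  term : ℕ → ℚ
  term i = 𝟙[odd] i * (binomℚ k i * monomial j i)
  term-nonNeg : ∀ i → NonNegative (term i)
  term-nonNeg i = nonNeg*nonNeg⇒nonNeg (𝟙[odd] i) {{𝟙[odd]-nonNeg i}} _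
    {{nonNeg*nonNeg⇒nonNeg (binomℚ k i) {{ℕ→ℚ-nonNeg (k C i)}} (monomial j i) {{monomial-nonNeg j i}}}}
  term-1≡k : term 1 ≡ ℕ→ℚ k
  term-1≡k = begin
    1ℚ * (binomℚ k 1 * monomial j 1) ≡⟨ *-identityˡ _ ⟩
    binomℚ k 1 * monomial j 1        ≡⟨ cong₂ _*_ (cong ℕ→ℚ (nC1≡n k)) (monomial-at-1 j) ⟩
    ℕ→ℚ k * 1ℚ                       ≡⟨ *-identityʳ (ℕ→ℚ k) ⟩
    ℕ→ℚ k                            ∎
    where open ≡-Reasoning

÷?-*-cancel : ∀ x {y} → y ≢ 0ℚ → (x ÷? y) * y ≡ x
÷?-*-cancel x {y} y≢0 with y ≟ 0ℚ
... | yes y≡0 = contradiction y≡0 y≢0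
... | no  y≢0 = begin
  x * 1/ y * y   ≡⟨ *-assoc x (1/ y) y ⟩
  x * (1/ y * y) ≡⟨ cong (x *_) (*-inverseˡ y) ⟩
  x * 1ℚ         ≡⟨ *-identityʳ x ⟩
  x              ∎
  where
  open ≡-Reasoning
  instance _ = ≢-nonZero y≢0

÷?-unique : ∀ {x y} z → y ≢ 0ℚ → x ≡ z * y → x ÷? y ≡ z
÷?-unique {x} {y} z y≢0 x≡zy with y ≟ 0ℚ
... | yes y≡0 = contradiction y≡0 y≢0
... | no  y≢0 = begin
  x * 1/ y       ≡⟨ cong (_* 1/ y) x≡zy ⟩
  z * y * 1/ y   ≡⟨ *-assoc z y (1/ y) ⟩
  z * (y * 1/ y) ≡⟨ cong (z *_) (*-inverseʳ y) ⟩
  z * 1ℚ         ≡⟨ *-identityʳ z ⟩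
  z              ∎
  where
  open ≡-Reasoning
  instance _ = ≢-nonZero y≢0

÷?≡*1÷? : ∀ x y → x ÷? y ≡ x * (1ℚ ÷? y)
÷?≡*1÷? x y with y ≟ 0ℚ
... | yes _ = sym (*-zeroʳ x)
... | no  _ = cong (x *_) (sym (*-identityˡ _))

1÷?-pos : ∀ y → Positive y → Positive (1ℚ ÷? y)
1÷?-pos y y>0 with y ≟ 0ℚ
... | yes y≡0 = contradiction y≡0 (pos⇒≢0 y y>0)
... | no  y≢0 = subst Positive (sym (*-identityˡ ((1/ y) {{≢-nonZero y≢0}}))) (1/pos⇒pos y {{y>0}})

÷?-cancelˡ : ∀ x y z → Positive x → Positive z → (x * y) ÷? (x * z) ≡ y ÷? z
÷?-cancelˡ x y z x>0 z>0 = ÷?-unique (y ÷? z) (pos⇒≢0 (x * z) xz>0) (begin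
  x * y                ≡⟨ cong (x *_) (sym (÷?-*-cancel y (pos⇒≢0 z z>0))) ⟩
  x * ((y ÷? z) * z)   ≡⟨ *-CS.x∙yz≈y∙xz x (y ÷? z) z ⟩
  (y ÷? z) * (x * z)   ∎)
  where
  open ≡-Reasoning
  xz>0 : Positive (x * z)
  xz>0 = pos*pos⇒pos x {{x>0}} z {{z>0}}

1÷?-antitone : ∀ {x y} → Positive x → x ≤ y → 1ℚ ÷? y ≤ 1ℚ ÷? x
1÷?-antitone {x} {y} x>0 x≤y = *-cancelʳ-≤-pos x {{x>0}} (begin
  (1ℚ ÷? y) * x ≤⟨ *-monoˡ-≤-nonNeg (1ℚ ÷? y) {{pos⇒nonNeg (1ℚ ÷? y) {{1÷?-pos y y>0}}}} x≤y ⟩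
  (1ℚ ÷? y) * y ≡⟨ ÷?-*-cancel 1ℚ (pos⇒≢0 y y>0) ⟩
  1ℚ            ≡⟨ sym (÷?-*-cancel 1ℚ (pos⇒≢0 x x>0)) ⟩
  (1ℚ ÷? x) * x ∎)
  where
  open ≤-Reasoning
  y>0 : Positive y
  y>0 = positive (<-≤-trans (positive⁻¹ x {{x>0}}) x≤y)

ProportionalMoments-of-common-factor : ∀ k {m₁ m₂} (S : ℕ → ℚ) a b → Positive a → (∀ j → Positive (S j)) →
  (∀ j → 1 ℕ.≤ j → j ℕ.≤ k ∸ 1 → m₁ j ≡ S j * a × m₂ j ≡ S j * b) →
  ProportionalMoments k m₁ m₂
ProportionalMoments-of-common-factor k {m₁} {m₂} S a b a>0 S>0 m≡S* =
  (λ j 1≤j j<k → pos⇒≢0 (m₁ j) (subst Positive (sym (proj₁ (m≡S* j 1≤j j<k))) (Sa>0 j))) ,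
  (λ i j 1≤i i<k 1≤j j<k → trans (ratio≡b÷?a i 1≤i i<k) (sym (ratio≡b÷?a j 1≤j j<k)))
  where
  Sa>0 : ∀ j → Positive (S j * a)
  Sa>0 j = pos*pos⇒pos (S j) {{S>0 j}} a {{a>0}}
  ratio≡b÷?a : ∀ j → 1 ℕ.≤ j → j ℕ.≤ k ∸ 1 → m₂ j ÷? m₁ j ≡ b ÷? a
  ratio≡b÷?a j 1≤j j<k = let (m₁≡ , m₂≡) = m≡S* j 1≤j j<k in
    trans (cong₂ _÷?_ m₂≡ m₁≡) (÷?-cancelˡ (S j) b a (S>0 j) a>0)

moment-binomialSum : ∀ k d s c → (∀ i → d i ≡ s i * (binomℚ k i * c)) →
  ∀ j → moment k d (suc j) ≡ binomialSum k s (monomial (suc j)) * c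
moment-binomialSum k d s c d≡ j = begin
  moment k d (suc j)                                   ≡⟨ sumFrom1≡∑≤ k (λ i → d i * monomial (suc j) i) (trans (cong (d 0 *_) (*-zeroˡ (monomial j 0))) (*-zeroʳ (d 0))) ⟩
  ∑≤ k (λ i → d i * monomial (suc j) i)                ≡⟨ ∑≤-cong k (λ i → trans (cong (_* monomial (suc j) i) (d≡ i)) (reassoc (s i) (binomℚ k i) c (monomial (suc j) i))) ⟩
  ∑≤ k (λ i → s i * (binomℚ k i * monomial (suc j) i) * c) ≡⟨ ∑≤-distribʳ-* k (λ i → s i * (binomℚ k i * monomial (suc j) i)) c ⟩
  binomialSum k s (monomial (suc j)) * c               ∎
  where
  open ≡-Reasoning
  reassoc : ∀ s b c x → s * (b * c) * x ≡ s * (b * x) * c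
  reassoc = solve-∀ ℚ-ring

𝟙[odd]-weight : ∀ i x c → (if isEven i then 0ℚ else x ÷? c) ≡ 𝟙[odd] i * (x * (1ℚ ÷? c))
𝟙[odd]-weight i x c with isEven i
... | true  = sym (*-zeroˡ (x * (1ℚ ÷? c)))
... | false = trans (÷?≡*1÷? x c) (sym (*-identityˡ (x * (1ℚ ÷? c))))

𝟙[even]-weight : ∀ i x c → (if isEven i then x ÷? c else 0ℚ) ≡ 𝟙[even] i * (x * (1ℚ ÷? c))
𝟙[even]-weight i x c with isEven i
... | true  = trans (÷?≡*1÷? x c) (sym (*-identityˡ (x * (1ℚ ÷? c))))
... | false = sym (*-zeroˡ (x * (1ℚ ÷? c)))

module _ (k : ℕ) where

  𝐩-weights-even : isEven k ≡ true → ∀ i → 𝐩 k i ≡ 𝟙[odd] i * (binomℚ k i * (1ℚ ÷? A k))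
  𝐩-weights-even even i = trans (if-cong even) (𝟙[odd]-weight i (binomℚ k i) (A k))

  𝐪-weights-even : isEven k ≡ true → ∀ i → 𝐪 k i ≡ 𝟙[even] i * (binomℚ k i * (1ℚ ÷? B k))
  𝐪-weights-even even i = trans (if-cong even) (𝟙[even]-weight i (binomℚ k i) (B k))

  𝐩-weights-odd : isEven k ≡ false → ∀ i → 𝐩 k i ≡ 𝟙[even] i * (binomℚ k i * (1ℚ ÷? B k))
  𝐩-weights-odd odd i = trans (if-cong odd) (𝟙[even]-weight i (binomℚ k i) (B k))

  𝐪-weights-odd : isEven k ≡ false → ∀ i → 𝐪 k i ≡ 𝟙[odd] i * (binomℚ k i * (1ℚ ÷? A k))
  𝐪-weights-odd odd i = trans (if-cong odd) (𝟙[odd]-weight i (binomℚ k i) (A k))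

  𝐩-diagonal : 𝐩 k k ≡ 0ℚ
  𝐩-diagonal = off-support (isEven k)
    where
    off-support : ∀ b {x y} → (if b then (if b then 0ℚ else x) else (if b then y else 0ℚ)) ≡ 0ℚ
    off-support true  = refl
    off-support false = refl

  𝐪-diagonal : 𝐪 k k ≡ (if isEven k then 1ℚ ÷? B k else 1ℚ ÷? A k)
  𝐪-diagonal = trans (on-support (isEven k)) (cong (λ c → if isEven k then ℕ→ℚ c ÷? B k else ℕ→ℚ c ÷? A k) (nCn≡1 k))
    where
    on-support : ∀ b {x y} → (if b then (if b then x else 0ℚ) else (if b then 0ℚ else y)) ≡ (if b then x else y)
    on-support true  = refl
    on-support false = refl

2^[1+m]∸1≢0 : ∀ m → ℕ.NonZero (2 ^ suc m ∸ 1)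
2^[1+m]∸1≢0 m = ℕ.>-nonZero (ℕ.∸-monoˡ-≤ 1 (ℕ.^-monoʳ-≤ 2 (s≤s (z≤n {m}))))

1÷?-antitone-ℕ : ∀ {m n} .{{_ : ℕ.NonZero m}} → m ℕ.≤ n → 1ℚ ÷? ℕ→ℚ n ≤ 1ℚ ÷? ℕ→ℚ m
1÷?-antitone-ℕ {m} m≤n = 1÷?-antitone (ℕ→ℚ-pos m) (ℕ→ℚ-mono-≤ m≤n)

𝐪-diagonal-lower-bound : ∀ m → 1ℚ ÷? ℕ→ℚ (2 ^ suc (suc m)) ≤ 𝐪 (suc (suc m)) (suc (suc m))
𝐪-diagonal-lower-bound m = subst (1ℚ ÷? ℕ→ℚ (2 ^ k) ≤_) (sym (𝐪-diagonal k)) (by-parity (isEven k))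
  where
  k = suc (suc m)
  2^[1+m]≤2^k : 2 ^ suc m ℕ.≤ 2 ^ k
  2^[1+m]≤2^k = ℕ.^-monoʳ-≤ 2 (ℕ.n≤1+n (suc m))
  by-parity : ∀ b → 1ℚ ÷? ℕ→ℚ (2 ^ k) ≤ (if b then 1ℚ ÷? B k else 1ℚ ÷? A k)
  by-parity true  = 1÷?-antitone-ℕ {{2^[1+m]∸1≢0 m}} (ℕ.≤-trans (ℕ.m∸n≤m _ 1) 2^[1+m]≤2^k)
  by-parity false = 1÷?-antitone-ℕ {{ℕ.m^n≢0 2 (suc m)}} 2^[1+m]≤2^k

lemma3 : (k : ℕ) → k ≥ 2 →
    ((𝐩 k k ≡ 0ℚ) × (((+ 1) / 1) ÷? ℕ→ℚ (2 ^ k)) ≤ 𝐪 k k)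
    × ProportionalMoments k (moment k (𝐩 k)) (moment k (𝐪 k))
lemma3 k@(suc (suc m)) (s≤s (s≤s z≤n)) = (𝐩-diagonal k , 𝐪-diagonal-lower-bound m) , by-parity (isEven k) refl
  where
  S : ℕ → ℚ
  S j = binomialSum k 𝟙[odd] (monomial j)
  α β : ℚ
  α = 1ℚ ÷? A k
  β = 1ℚ ÷? B k
  α>0 : Positive α
  α>0 = 1÷?-pos (A k) (ℕ→ℚ-pos (2 ^ suc m) {{ℕ.m^n≢0 2 (suc m)}})
  β>0 : Positive β
  β>0 = 1÷?-pos (B k) (ℕ→ℚ-pos (2 ^ suc m ∸ 1) {{2^[1+m]∸1≢0 m}})
  even≡odd : ∀ j → j ℕ.≤ k ∸ 1 → binomialSum k 𝟙[even] (monomial j) ≡ S j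
  even≡odd j j<k = binomialSum-even≡odd k {monomial j} (DegreeBelow-mono {f = monomial j} (s≤s j<k) (DegreeBelow-monomial j))
  by-parity : ∀ b → isEven k ≡ b → ProportionalMoments k (moment k (𝐩 k)) (moment k (𝐪 k))
  by-parity true even = ProportionalMoments-of-common-factor k S α β α>0 (binomialSum-odd-monomial-pos (suc m))
    λ { (suc j) _ j<k →
      moment-binomialSum k (𝐩 k) 𝟙[odd] α (𝐩-weights-even k even) j ,
      trans (moment-binomialSum k (𝐪 k) 𝟙[even] β (𝐪-weights-even k even) j) (cong (_* β) (even≡odd (suc j) j<k)) }
  by-parity false odd = ProportionalMoments-of-common-factor k S β α β>0 (binomialSum-odd-monomial-pos (suc m))
    λ { (suc j) _ j<k →
      trans (moment-binomialSum k (𝐩 k) 𝟙[even] β (𝐩-weights-odd k odd) j) (cong (_* β) (even≡odd (suc j) j<k)) ,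
      moment-binomialSum k (𝐪 k) 𝟙[odd] α (𝐪-weights-odd k odd) j }
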